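{- For every positive integer $k$, \[\prod_{i=1}^k(2+\beta x_i)=2^k-\sum_{j=1}^k2^{k-j}(-\beta)^j\mathcal{G}^{(\beta)}_{[1^j\mid k]}.\]
   Context: Grothendieck polynomials $\mathcal{G}^{(\beta)}_w$ for permutations $w$ of $\mathbb{Z}$ fixing $i\le0$ and all but finitely many $i$: determined by $\mathcal{G}^{(\beta)}_{n\cdots21}=x_1^{n-1}x_2^{n-2}\cdots x_{n-1}$ and $\partial^{(\beta)}_i\mathcal{G}^{(\beta)}_w=\mathcal{G}^{(\beta)}_{ws_i}$ if $w(i)>w(i+1)$, $-\beta\mathcal{G}^{(\beta)}_w$ otherwise, where $\partial^{(\beta)}_if=\partial_i((1+\beta x_{i+1})f)$, $\partial_if=(f-s_if)/(x_i-x_{i+1})$. For $1\le m\le k$, $[1^m\mid k]$ is the permutation with one-line notation $1,2,\dots,k-m,\ k-m+2,k-m+3,\dots,k+1,\ k-m+1$ (fixing all $i>k+1$); e.g. $[1^k\mid k]=2\,3\cdots(k+1)\,1$. -}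

module Defs where

open import Data.Nat as ℕ using (ℕ; zero; suc; _≡ᵇ_; _≤ᵇ_)
open import Data.Integer using (ℤ; +_; _+_; _-_; _*_; -_; _^_)
open import Data.Bool using (if_then_else_)
open import Data.Product using (_×_; _,_)
open import Data.List using (List; []; _∷_)
open import Relation.Binary.PropositionalEquality using (_≡_)

-- A monomial is a list of exponents: position j is the exponent of y_j
-- (y₀ = β, y_i = x_i for i ≥ 1).

Mono : Set
Mono = List ℕ

Poly : Set
Poly = List (ℤ × Mono)

-- An assignment of integer values to the variables: a 0 = β, a i = x_i.
Assign : Set
Assign = ℕ → ℤ

evalMono : Mono → Assign → ℤ
evalMono []       a = + 1
evalMono (e ∷ es) a = a 0 ^ e * evalMono es (λ j → a (suc j))

eval : Poly → Assign → ℤ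
eval []             a = + 0
eval ((c , m) ∷ ps) a = c * evalMono m a + eval ps a

-- Equality of polynomials (ℤ is an infinite integral domain, so two
-- integer polynomials are equal iff they agree at every integer point).
_≈_ : Poly → Poly → Set
p ≈ q = ∀ (a : Assign) → eval p a ≡ eval q a

sumFrom1 : ℕ → (ℕ → ℤ) → ℤ
sumFrom1 zero    f = + 0
sumFrom1 (suc n) f = sumFrom1 n f + f (suc n)

prodFrom1 : ℕ → (ℕ → ℤ) → ℤ
prodFrom1 zero    f = + 1
prodFrom1 (suc n) f = prodFrom1 n f * f (suc n)

-- Permutations of ℤ fixing every i ≤ 0 and all but finitely many i,
-- represented by their restriction to ℕ (the value at 0 is 0).

IsFinPerm : (ℕ → ℕ) → Set
IsFinPerm w =
  (w 0 ≡ 0)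
  × (∀ i j → w i ≡ w j → i ≡ j)
  × Data.Product.Σ ℕ (λ n → ∀ i → n ℕ.< i → w i ≡ i)

s : ℕ → ℕ → ℕ
s i j = if j ≡ᵇ i then suc i else (if j ≡ᵇ suc i then i else j)

w₀ : ℕ → ℕ → ℕ
w₀ n zero    = zero
w₀ n (suc i) = if suc i ≤ᵇ n then n ℕ.∸ i else suc i

-- [1^m | k] : 1,2,…,k-m, k-m+2,…,k+1, k-m+1   (fixing all i > k+1, and 0)
perm1m|k : ℕ → ℕ → ℕ → ℕ
perm1m|k m k i =
  if i ≤ᵇ k ℕ.∸ m then i
  else (if i ≤ᵇ k then suc i
  else (if i ≡ᵇ suc k then suc (k ℕ.∸ m) else i))

-- β-divided difference, as a relation:  h = ∂^{(β)}_i f  means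
--   (x_i - x_{i+1}) · h = (1 + β x_{i+1}) f - s_i((1 + β x_{i+1}) f),
-- i.e. h = ∂_i((1 + β x_{i+1}) f).

swapA : ℕ → Assign → Assign
swapA i a j = a (s i j)

IsDDβ : ℕ → Poly → (Assign → ℤ) → Set
IsDDβ i f h =
  ∀ (a : Assign) →
    (a i - a (suc i)) * h a
      ≡ (+ 1 + a 0 * a (suc i)) * eval f a
        - (+ 1 + a 0 * a i) * eval f (swapA i a)

-- The defining properties of the β-Grothendieck polynomials 𝔊^{(β)}_w.
-- (These determine the family uniquely.)

record IsGrothendieck (G : (ℕ → ℕ) → Poly) : Set where
  field
    resp : ∀ w v → (∀ i → w i ≡ v i) → G w ≈ G v
    top  : ∀ n (a : Assign) →
             eval (G (w₀ n)) a ≡ prodFrom1 n (λ i → a i ^ (n ℕ.∸ i))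
    desc : ∀ w → IsFinPerm w → ∀ i → 1 ℕ.≤ i → w (suc i) ℕ.< w i →
             IsDDβ i (G w) (eval (G (λ j → w (s i j))))
    asc  : ∀ w → IsFinPerm w → ∀ i → 1 ℕ.≤ i → w i ℕ.< w (suc i) →
             IsDDβ i (G w) (λ a → - a 0 * eval (G w) a)

-- Call an assignment generic if it is injective on β, x₁, …, x_{k+1}. At generic points x_i ≠ x_{i+1},
-- so the defining relations determine 𝔊_{w s_i} from 𝔊_w and Grothendieck polynomials can be computed
-- along chains of divided differences. Both sides of the identity are polynomial in each variable, and
-- such a function vanishing at all generic points vanishes everywhere.
--
-- Let E_j = w₀(k+1) s_{j+1} ⋯ s_k. Then 𝔊_{E_j} = x^δ x₁ ⋯ x_j with x^δ = x₁^{k-1} ⋯ x_{k-1}, and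
-- [1^j | k] = E_j ∘ rev_k, where rev_k reverses 1, …, k. The divided differences that turn 𝔊_W into
-- 𝔊_{W ∘ rev_k} send x^δ g to g for g symmetric in x₁, …, x_k, and by induction on k they send
-- Σ_{j ≤ k} 2^{k-j} (-β)^j x^δ x₁ ⋯ x_j σ to σ (2^{k+1} - ∏ᵢ (2 + β xᵢ)) for symmetric σ. Taking
-- σ = 1 and splitting off the term 2^k 𝔊_id = 2^k gives the identity.

module Submission where

open import Data.Bool using (true; false; if_then_else_)
open import Data.Empty using (⊥-elim)
open import Data.Integer as ℤ using (ℤ; +_; -[1+_]; _+_; _-_; _*_; -_; _^_; 0ℤ; 1ℤ)
import Data.Integer.Properties as ℤₚ
open import Data.Integer.Tactic.RingSolver using (solve-∀)
open import Data.List using (List; []; _∷_)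
open import Data.List.Relation.Unary.All using (All; []; _∷_)
open import Data.Nat as ℕ using (ℕ; zero; suc; _≤_; _<_; _∸_; z≤n; s≤s; _≡ᵇ_; _≤ᵇ_)
open import Data.Nat.Properties
open import Data.Product using (∃-syntax; _×_; _,_; proj₁; proj₂)
open import Data.Sum using (inj₁; inj₂)
open import Data.Unit using (⊤; tt)
open import Function using (_∘_)
open import Relation.Binary.PropositionalEquality hiding (resp)
open import Relation.Nullary using (yes; no)
open import Relation.Nullary.Reflects using (Reflects; ofʸ; ofⁿ; fromEquivalence)

open import Defs

≡ᵇ-reflects-≡ : ∀ m n → Reflects (m ≡ n) (m ≡ᵇ n)
≡ᵇ-reflects-≡ m n = fromEquivalence (≡ᵇ⇒≡ m n) (≡⇒≡ᵇ m n)

if-≡ᵇ-yes : ∀ {A : Set} {m n} {x y : A} → m ≡ n → (if m ≡ᵇ n then x else y) ≡ x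
if-≡ᵇ-yes {m = m} {n} m≡n with m ≡ᵇ n | ≡ᵇ-reflects-≡ m n
... | true  | _        = refl
... | false | ofⁿ m≢n = ⊥-elim (m≢n m≡n)

if-≡ᵇ-no : ∀ {A : Set} {m n} {x y : A} → m ≢ n → (if m ≡ᵇ n then x else y) ≡ y
if-≡ᵇ-no {m = m} {n} m≢n with m ≡ᵇ n | ≡ᵇ-reflects-≡ m n
... | false | _        = refl
... | true  | ofʸ m≡n = ⊥-elim (m≢n m≡n)

if-≤ᵇ-yes : ∀ {A : Set} {m n} {x y : A} → m ≤ n → (if m ≤ᵇ n then x else y) ≡ x
if-≤ᵇ-yes {m = m} {n} m≤n with m ≤ᵇ n | ≤ᵇ-reflects-≤ m n
... | true  | _        = refl
... | false | ofⁿ m≰n = ⊥-elim (m≰n m≤n)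

if-≤ᵇ-no : ∀ {A : Set} {m n} {x y : A} → n < m → (if m ≤ᵇ n then x else y) ≡ y
if-≤ᵇ-no {m = m} {n} n<m with m ≤ᵇ n | ≤ᵇ-reflects-≤ m n
... | false | _        = refl
... | true  | ofʸ m≤n = ⊥-elim (<⇒≱ n<m m≤n)

-- Polynomial functions ℤ → ℤ

Δ : (ℤ → ℤ) → ℤ → ℤ
Δ f t = f (t + 1ℤ) - f t

Degree< : ℕ → (ℤ → ℤ) → Set
Degree< zero    f = ∀ t → f t ≡ 0ℤ
Degree< (suc d) f = Degree< d (Δ f)

IsPolynomial : (ℤ → ℤ) → Set
IsPolynomial f = ∃[ d ] Degree< d f

degree<-cong : ∀ d {f g} → (∀ t → f t ≡ g t) → Degree< d f → Degree< d g
degree<-cong zero    f≗g f<0 t = trans (sym (f≗g t)) (f<0 t)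
degree<-cong (suc d) f≗g f<d = degree<-cong d (λ t → cong₂ _-_ (f≗g (t + 1ℤ)) (f≗g t)) f<d

degree<-zero : ∀ d → Degree< d (λ _ → 0ℤ)
degree<-zero zero    t = refl
degree<-zero (suc d) = degree<-zero d

degree<-mono : ∀ {d e} f → d ≤ e → Degree< d f → Degree< e f
degree<-mono {e = zero}  f z≤n       f<d = f<d
degree<-mono {e = suc e} f z≤n       f<0 =
  degree<-mono {e = e} (Δ f) z≤n (λ t → cong₂ _-_ (f<0 (t + 1ℤ)) (f<0 t))
degree<-mono             f (s≤s d≤e) f<d = degree<-mono (Δ f) d≤e f<d

degree<-shift : ∀ d f → Degree< d f → Degree< d (λ t → f (t + 1ℤ))
degree<-shift zero    f f<0 t = f<0 (t + 1ℤ)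
degree<-shift (suc d) f f<d   = degree<-shift d (Δ f) f<d

degree<-+ : ∀ d f g → Degree< d f → Degree< d g → Degree< d (λ t → f t + g t)
degree<-+ zero    f g f<0 g<0 t rewrite f<0 t | g<0 t = refl
degree<-+ (suc d) f g f<d g<d =
  degree<-cong d (λ t → Δ-+ (f (t + 1ℤ)) (f t) (g (t + 1ℤ)) (g t))
    (degree<-+ d (Δ f) (Δ g) f<d g<d)
  where
  Δ-+ : ∀ f₁ f₀ g₁ g₀ → (f₁ - f₀) + (g₁ - g₀) ≡ (f₁ + g₁) - (f₀ + g₀)
  Δ-+ = solve-∀

degree<-* : ∀ d e f g → Degree< d f → Degree< e g → Degree< (d ℕ.+ e) (λ t → f t * g t)
degree<-* zero e f g f<0 g<e =
  degree<-cong e (λ t → sym (trans (cong (_* g t) (f<0 t)) (ℤₚ.*-zeroˡ (g t)))) (degree<-zero e)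
degree<-* (suc d) zero f g f<d g<0 =
  degree<-cong (suc d ℕ.+ 0) (λ t → sym (trans (cong (f t *_) (g<0 t)) (ℤₚ.*-zeroʳ (f t))))
    (degree<-zero (suc d ℕ.+ 0))
degree<-* (suc d) (suc e) f g f<d g<e =
  degree<-cong (d ℕ.+ suc e) (λ t → Δ-* (f (t + 1ℤ)) (f t) (g (t + 1ℤ)) (g t))
    (degree<-+ (d ℕ.+ suc e) _ _
      (subst (λ n → Degree< n (λ t → f (t + 1ℤ) * Δ g t)) (sym (+-suc d e))
        (degree<-* (suc d) e (λ t → f (t + 1ℤ)) (Δ g) (degree<-shift (suc d) f f<d) g<e))
      (degree<-* d (suc e) (Δ f) g f<d g<e))
  where
  Δ-* : ∀ f₁ f₀ g₁ g₀ → f₁ * (g₁ - g₀) + (f₁ - f₀) * g₀ ≡ f₁ * g₁ - f₀ * g₀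
  Δ-* = solve-∀

degree<-vanishing-below : ∀ d g T → Degree< d g → (∀ n → g (T + + n) ≡ 0ℤ) →
                          ∀ n → g (T - + n) ≡ 0ℤ
degree<-vanishing-below zero    g T g<0 _     n = g<0 (T - + n)
degree<-vanishing-below (suc d) g T g<d above = below
  where
  above-suc : ∀ n → T + + n + 1ℤ ≡ T + + suc n
  above-suc n = identity T (+ n)
    where
    identity : ∀ T x → T + x + 1ℤ ≡ T + (1ℤ + x)
    identity = solve-∀

  below-suc : ∀ n → T - + suc n + 1ℤ ≡ T - + n
  below-suc n = identity T (+ n)
    where
    identity : ∀ T x → T - (1ℤ + x) + 1ℤ ≡ T - x
    identity = solve-∀

  Δg-below : ∀ n → Δ g (T - + n) ≡ 0ℤ
  Δg-below = degree<-vanishing-below d (Δ g) T g<d λ n →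
    cong₂ _-_ (trans (cong g (above-suc n)) (above (suc n))) (above n)

  below : ∀ n → g (T - + n) ≡ 0ℤ
  below zero    = above 0
  below (suc n) = begin
    g u                          ≡⟨ recover (g u) (g (u + 1ℤ)) ⟩
    g (u + 1ℤ) - Δ g u           ≡⟨ cong₂ _-_ (trans (cong g (below-suc n)) (below n)) (Δg-below (suc n)) ⟩
    0ℤ                           ∎
    where
    open ≡-Reasoning
    u = T - + suc n
    recover : ∀ x y → x ≡ y - (y - x)
    recover = solve-∀

isPolynomial-vanishing : ∀ {g} T → IsPolynomial g → (∀ n → g (T + + n) ≡ 0ℤ) → ∀ t → g t ≡ 0ℤ
isPolynomial-vanishing {g} T (d , g<d) above t =
  subst (λ u → g u ≡ 0ℤ) (T+[t-T]≡t t T) (everywhere (t - T))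
  where
  T+[t-T]≡t : ∀ t T → T + (t - T) ≡ t
  T+[t-T]≡t = solve-∀
  everywhere : ∀ u → g (T + u) ≡ 0ℤ
  everywhere (+ n)    = above n
  everywhere -[1+ n ] = degree<-vanishing-below d g T g<d above (suc n)

isPolynomial-cong : ∀ {f g} → (∀ t → f t ≡ g t) → IsPolynomial f → IsPolynomial g
isPolynomial-cong f≗g (d , f<d) = d , degree<-cong d f≗g f<d

isPolynomial-const : ∀ c → IsPolynomial (λ _ → c)
isPolynomial-const c = 1 , λ _ → ℤₚ.+-inverseʳ c

isPolynomial-id : IsPolynomial (λ t → t)
isPolynomial-id = 2 , λ t → ΔΔ-id t
  where
  ΔΔ-id : ∀ t → ((t + 1ℤ + 1ℤ) - (t + 1ℤ)) - ((t + 1ℤ) - t) ≡ 0ℤ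
  ΔΔ-id = solve-∀

isPolynomial-+ : ∀ {f g} → IsPolynomial f → IsPolynomial g → IsPolynomial (λ t → f t + g t)
isPolynomial-+ {f} {g} (d , f<d) (e , g<e) =
  d ℕ.+ e , degree<-+ (d ℕ.+ e) f g (degree<-mono f (m≤m+n d e) f<d) (degree<-mono g (m≤n+m e d) g<e)

isPolynomial-* : ∀ {f g} → IsPolynomial f → IsPolynomial g → IsPolynomial (λ t → f t * g t)
isPolynomial-* {f} {g} (d , f<d) (e , g<e) = d ℕ.+ e , degree<-* d e f g f<d g<e

isPolynomial-neg : ∀ {f} → IsPolynomial f → IsPolynomial (λ t → - f t)
isPolynomial-neg {f} f-poly =
  isPolynomial-cong (λ t → ℤₚ.-1*i≡-i (f t)) (isPolynomial-* (isPolynomial-const ℤ.-1ℤ) f-poly)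

isPolynomial-^ : ∀ {f} n → IsPolynomial f → IsPolynomial (λ t → f t ^ n)
isPolynomial-^ zero    f-poly = isPolynomial-const 1ℤ
isPolynomial-^ (suc n) f-poly = isPolynomial-* f-poly (isPolynomial-^ n f-poly)

isPolynomial-evalMono : ∀ m (b : ℤ → Assign) → (∀ j → IsPolynomial (λ t → b t j)) →
                        IsPolynomial (λ t → evalMono m (b t))
isPolynomial-evalMono []      b b-poly = isPolynomial-const 1ℤ
isPolynomial-evalMono (e ∷ m) b b-poly =
  isPolynomial-* (isPolynomial-^ e (b-poly 0))
                 (isPolynomial-evalMono m (λ t j → b t (suc j)) (λ j → b-poly (suc j)))

isPolynomial-eval : ∀ p (b : ℤ → Assign) → (∀ j → IsPolynomial (λ t → b t j)) →
                    IsPolynomial (λ t → eval p (b t))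
isPolynomial-eval []            b b-poly = isPolynomial-const 0ℤ
isPolynomial-eval ((c , m) ∷ p) b b-poly =
  isPolynomial-+ (isPolynomial-* (isPolynomial-const c) (isPolynomial-evalMono m b b-poly))
                 (isPolynomial-eval p b b-poly)

evalMono-cong : ∀ m {a b : Assign} → (∀ j → a j ≡ b j) → evalMono m a ≡ evalMono m b
evalMono-cong []      a≗b = refl
evalMono-cong (e ∷ m) a≗b = cong₂ (λ x y → x ^ e * y) (a≗b 0) (evalMono-cong m (λ j → a≗b (suc j)))

eval-cong : ∀ p {a b : Assign} → (∀ j → a j ≡ b j) → eval p a ≡ eval p b
eval-cong []            a≗b = refl
eval-cong ((c , m) ∷ p) a≗b = cong₂ (λ x y → c * x + y) (evalMono-cong m a≗b) (eval-cong p a≗b)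

update : Assign → ℕ → ℤ → Assign
update a i t j = if j ≡ᵇ i then t else a j

update-same : ∀ a i t → update a i t i ≡ t
update-same a i t = if-≡ᵇ-yes {m = i} refl

update-other : ∀ a i t {j} → j ≢ i → update a i t j ≡ a j
update-other a i t {j} j≢i = if-≡ᵇ-no {m = j} j≢i

update-self : ∀ a i j → update a i (a i) j ≡ a j
update-self a i j with j ≡ᵇ i | ≡ᵇ-reflects-≡ j i
... | true  | ofʸ refl = refl
... | false | _        = refl

isPolynomial-update : ∀ a i j → IsPolynomial (λ t → update a i t j)
isPolynomial-update a i j with j ≡ᵇ i
... | true  = isPolynomial-id
... | false = isPolynomial-const (a j)

record IsPolynomialFunction (F : Assign → ℤ) : Set where
  field
    respects : ∀ {a b} → (∀ j → a j ≡ b j) → F a ≡ F b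
    along    : ∀ a i → IsPolynomial (λ t → F (update a i t))

open IsPolynomialFunction

polyFun-const : ∀ c → IsPolynomialFunction (λ _ → c)
polyFun-const c .respects _  = refl
polyFun-const c .along    _ _ = isPolynomial-const c

polyFun-var : ∀ j → IsPolynomialFunction (λ a → a j)
polyFun-var j .respects a≗b = a≗b j
polyFun-var j .along a i    = isPolynomial-update a i j

polyFun-+ : ∀ {F F′} → IsPolynomialFunction F → IsPolynomialFunction F′ →
            IsPolynomialFunction (λ a → F a + F′ a)
polyFun-+ F F′ .respects a≗b = cong₂ _+_ (F .respects a≗b) (F′ .respects a≗b)
polyFun-+ F F′ .along a i    = isPolynomial-+ (F .along a i) (F′ .along a i)

polyFun-* : ∀ {F F′} → IsPolynomialFunction F → IsPolynomialFunction F′ →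
            IsPolynomialFunction (λ a → F a * F′ a)
polyFun-* F F′ .respects a≗b = cong₂ _*_ (F .respects a≗b) (F′ .respects a≗b)
polyFun-* F F′ .along a i    = isPolynomial-* (F .along a i) (F′ .along a i)

polyFun-neg : ∀ {F} → IsPolynomialFunction F → IsPolynomialFunction (λ a → - F a)
polyFun-neg F .respects a≗b = cong -_ (F .respects a≗b)
polyFun-neg F .along a i    = isPolynomial-neg (F .along a i)

polyFun-^ : ∀ {F} n → IsPolynomialFunction F → IsPolynomialFunction (λ a → F a ^ n)
polyFun-^ n F .respects a≗b = cong (_^ n) (F .respects a≗b)
polyFun-^ n F .along a i    = isPolynomial-^ n (F .along a i)

polyFun-eval : ∀ p → IsPolynomialFunction (eval p)
polyFun-eval p .respects a≗b = eval-cong p a≗b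
polyFun-eval p .along a i    = isPolynomial-eval p (update a i) (isPolynomial-update a i)

polyFun-prod : ∀ n (F : ℕ → Assign → ℤ) → (∀ i → IsPolynomialFunction (F i)) →
               IsPolynomialFunction (λ a → prodFrom1 n (λ i → F i a))
polyFun-prod zero    F F-poly = polyFun-const 1ℤ
polyFun-prod (suc n) F F-poly = polyFun-* (polyFun-prod n F F-poly) (F-poly (suc n))

polyFun-sum : ∀ n (F : ℕ → Assign → ℤ) → (∀ i → IsPolynomialFunction (F i)) →
              IsPolynomialFunction (λ a → sumFrom1 n (λ i → F i a))
polyFun-sum zero    F F-poly = polyFun-const 0ℤ
polyFun-sum (suc n) F F-poly = polyFun-+ (polyFun-sum n F F-poly) (F-poly (suc n))

InjectiveUpTo : ℕ → Assign → Set
InjectiveUpTo m a = ∀ {p q} → p ≤ m → q ≤ m → a p ≡ a q → p ≡ q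

_≐[_]_ : (Assign → ℤ) → ℕ → (Assign → ℤ) → Set
f ≐[ N ] g = ∀ a → InjectiveUpTo N a → f a ≡ g a

≤-suc-≢ : ∀ {p m} → p ≤ suc m → p ≢ suc m → p ≤ m
≤-suc-≢ p≤ p≢ = m<1+n⇒m≤n (≤∧≢⇒< p≤ p≢)

bounded-above : ∀ m (a : Assign) → ∃[ B ] (∀ p → p ≤ m → a p ℤ.< B)
bounded-above zero    a = ℤ.suc (a 0) , λ { _ z≤n → ℤₚ.suc[i]≤j⇒i<j ℤₚ.≤-refl }
bounded-above (suc m) a with bounded-above m a
... | B , a<B = B ℤ.⊔ ℤ.suc (a (suc m)) , a<B′
  where
  a<B′ : ∀ p → p ≤ suc m → a p ℤ.< B ℤ.⊔ ℤ.suc (a (suc m))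
  a<B′ p p≤ with p ≟ suc m
  ... | yes refl = ℤₚ.<-≤-trans (ℤₚ.suc[i]≤j⇒i<j ℤₚ.≤-refl) (ℤₚ.i≤j⊔i B _)
  ... | no  p≢   = ℤₚ.<-≤-trans (a<B p (≤-suc-≢ p≤ p≢)) (ℤₚ.i≤i⊔j B _)

update-injective : ∀ m a t → InjectiveUpTo m a → (∀ p → p ≤ m → a p ℤ.< t) →
                   InjectiveUpTo (suc m) (update a (suc m) t)
update-injective m a t inj a<t {p} {q} p≤ q≤ eq with p ≟ suc m | q ≟ suc m
... | yes p≡ | yes q≡ = trans p≡ (sym q≡)
... | yes refl | no q≢ =
  ⊥-elim (ℤₚ.<⇒≢ (a<t q (≤-suc-≢ q≤ q≢))
                  (sym (trans (sym (update-same a _ t)) (trans eq (update-other a _ t q≢)))))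
... | no p≢ | yes refl =
  ⊥-elim (ℤₚ.<⇒≢ (a<t p (≤-suc-≢ p≤ p≢))
                  (trans (sym (update-other a _ t p≢)) (trans eq (update-same a _ t))))
... | no p≢ | no q≢ =
  inj (≤-suc-≢ p≤ p≢) (≤-suc-≢ q≤ q≢)
      (trans (sym (update-other a _ t p≢)) (trans eq (update-other a _ t q≢)))

-- A polynomial in x_i that vanishes for all large x_i vanishes, so zeros spread from injective points.
polyFun-vanishing : ∀ {F} → IsPolynomialFunction F → ∀ m → F ≐[ m ] (λ _ → 0ℤ) → ∀ a → F a ≡ 0ℤ
polyFun-vanishing F-poly zero    F≐0 a = F≐0 a λ { z≤n z≤n _ → refl }
polyFun-vanishing {F} F-poly (suc m) F≐0 = polyFun-vanishing F-poly m F≐0-on-m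
  where
  F≐0-on-m : F ≐[ m ] (λ _ → 0ℤ)
  F≐0-on-m a inj = begin
    F a                              ≡⟨ F-poly .respects (λ j → sym (update-self a (suc m) j)) ⟩
    F (update a (suc m) (a (suc m))) ≡⟨ isPolynomial-vanishing B (F-poly .along a (suc m)) far (a (suc m)) ⟩
    0ℤ                               ∎
    where
    open ≡-Reasoning
    B = proj₁ (bounded-above m a)
    far : ∀ n → F (update a (suc m) (B + + n)) ≡ 0ℤ
    far n = F≐0 _ (update-injective m a (B + + n) inj λ p p≤m →
                     ℤₚ.<-≤-trans (proj₂ (bounded-above m a) p p≤m) (ℤₚ.i≤i+j B (+ n)))

polyFun-≐⇒≡ : ∀ {F F′} → IsPolynomialFunction F → IsPolynomialFunction F′ → ∀ m →
              F ≐[ m ] F′ → ∀ a → F a ≡ F′ a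
polyFun-≐⇒≡ F-poly F′-poly m F≐F′ a =
  ℤₚ.i-j≡0⇒i≡j _ _ (polyFun-vanishing (polyFun-+ F-poly (polyFun-neg F′-poly)) m
                      (λ a inj → ℤₚ.i≡j⇒i-j≡0 (F≐F′ a inj)) a)

-- Permutations

s-left : ∀ i → s i i ≡ suc i
s-left i = if-≡ᵇ-yes {m = i} refl

s-right : ∀ i → s i (suc i) ≡ i
s-right i = trans (if-≡ᵇ-no {m = suc i} 1+n≢n) (if-≡ᵇ-yes {m = suc i} refl)

s-fix : ∀ i {j} → j ≢ i → j ≢ suc i → s i j ≡ j
s-fix i {j} j≢i j≢1+i = trans (if-≡ᵇ-no {m = j} j≢i) (if-≡ᵇ-no {m = j} j≢1+i)

s-fix-< : ∀ i {j} → j < i → s i j ≡ j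
s-fix-< i j<i = s-fix i (<⇒≢ j<i) (<⇒≢ (m<n⇒m<1+n j<i))

s-fix-> : ∀ i {j} → suc i < j → s i j ≡ j
s-fix-> i 1+i<j = s-fix i (>⇒≢ (<-trans (n<1+n i) 1+i<j)) (>⇒≢ 1+i<j)

s-fix-0 : ∀ {i} → 1 ≤ i → s i 0 ≡ 0
s-fix-0 {i} 1≤i = s-fix-< i 1≤i

s-involutive : ∀ i j → s i (s i j) ≡ j
s-involutive i j with j ≟ i | j ≟ suc i
... | yes refl | _        = trans (cong (s i) (s-left i)) (s-right i)
... | no _     | yes refl = trans (cong (s i) (s-right i)) (s-left i)
... | no j≢i   | no j≢1+i = trans (cong (s i) (s-fix i j≢i j≢1+i)) (s-fix i j≢i j≢1+i)

s-injective : ∀ i {j k} → s i j ≡ s i k → j ≡ k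
s-injective i {j} {k} eq = trans (sym (s-involutive i j)) (trans (cong (s i) eq) (s-involutive i k))

s-≤ : ∀ {i N p} → suc i ≤ N → p ≤ N → s i p ≤ N
s-≤ {i} {N} {p} 1+i≤N p≤N with p ≟ i | p ≟ suc i
... | yes refl | _        = subst (_≤ N) (sym (s-left i)) 1+i≤N
... | no _     | yes refl = subst (_≤ N) (sym (s-right i)) (≤-trans (n≤1+n i) 1+i≤N)
... | no p≢i   | no p≢1+i = subst (_≤ N) (sym (s-fix i p≢i p≢1+i)) p≤N

isFinPerm-id : IsFinPerm (λ x → x)
isFinPerm-id = refl , (λ _ _ eq → eq) , 0 , λ _ _ → refl

isFinPerm-∘ : ∀ {V π} → IsFinPerm V → IsFinPerm π → IsFinPerm (λ x → V (π x))
isFinPerm-∘ {V} (V0 , V-inj , n , V-fix) (π0 , π-inj , m , π-fix) =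
  trans (cong V π0) V0 ,
  (λ i j eq → π-inj i j (V-inj _ _ eq)) ,
  n ℕ.+ m ,
  λ i n+m<i → trans (cong V (π-fix i (≤-<-trans (m≤n+m m n) n+m<i))) (V-fix i (≤-<-trans (m≤m+n n m) n+m<i))

isFinPerm-cong : ∀ {V W} → (∀ x → V x ≡ W x) → IsFinPerm V → IsFinPerm W
isFinPerm-cong V≗W (V0 , V-inj , n , V-fix) =
  trans (sym (V≗W 0)) V0 ,
  (λ i j eq → V-inj i j (trans (V≗W i) (trans eq (sym (V≗W j))))) ,
  n ,
  λ i n<i → trans (sym (V≗W i)) (V-fix i n<i)

isFinPerm-s : ∀ {i} → 1 ≤ i → IsFinPerm (s i)
isFinPerm-s {i} 1≤i = s-fix-0 1≤i , (λ _ _ → s-injective i) , suc i , λ _ → s-fix-> i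

-- The letters act in reverse order: 𝔊_{V ∘ sProd [i₁, …, iₙ]} = ∂_{iₙ} ⋯ ∂_{i₁} 𝔊_V.
sProd : List ℕ → ℕ → ℕ
sProd []      x = x
sProd (i ∷ l) x = s i (sProd l x)

isFinPerm-sProd : ∀ {l} → All (1 ≤_) l → IsFinPerm (sProd l)
isFinPerm-sProd []            = isFinPerm-id
isFinPerm-sProd (1≤i ∷ 1≤l) = isFinPerm-∘ (isFinPerm-s 1≤i) (isFinPerm-sProd 1≤l)

wordDown : ℕ → List ℕ
wordDown zero    = []
wordDown (suc r) = suc r ∷ wordDown r

wordUp : ℕ → ℕ → List ℕ
wordUp i zero    = []
wordUp i (suc n) = suc i ∷ wordUp (suc i) n

wordDown-positive : ∀ r → All (1 ≤_) (wordDown r)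
wordDown-positive zero    = []
wordDown-positive (suc r) = s≤s z≤n ∷ wordDown-positive r

wordUp-positive : ∀ i n → All (1 ≤_) (wordUp i n)
wordUp-positive i zero    = []
wordUp-positive i (suc n) = s≤s z≤n ∷ wordUp-positive (suc i) n

sProd-down-1 : ∀ r → sProd (wordDown r) 1 ≡ suc r
sProd-down-1 zero    = refl
sProd-down-1 (suc r) = trans (cong (s (suc r)) (sProd-down-1 r)) (s-left (suc r))

sProd-down-> : ∀ r {x} → suc r < x → sProd (wordDown r) x ≡ x
sProd-down-> zero    _     = refl
sProd-down-> (suc r) 2+r<x =
  trans (cong (s (suc r)) (sProd-down-> r (<-trans (n<1+n _) 2+r<x))) (s-fix-> (suc r) 2+r<x)

sProd-down-suc : ∀ r {x} → 1 ≤ x → x ≤ r → sProd (wordDown r) (suc x) ≡ x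
sProd-down-suc zero    (s≤s _) ()
sProd-down-suc (suc r) {x} 1≤x x≤1+r with x ≟ suc r
... | yes refl = trans (cong (s (suc r)) (sProd-down-> r ≤-refl)) (s-right (suc r))
... | no x≢1+r = trans (cong (s (suc r)) (sProd-down-suc r 1≤x (≤-suc-≢ x≤1+r x≢1+r)))
                       (s-fix-< (suc r) (≤∧≢⇒< x≤1+r x≢1+r))

sProd-up-≤ : ∀ i n {x} → x ≤ i → sProd (wordUp i n) x ≡ x
sProd-up-≤ i zero    x≤i = refl
sProd-up-≤ i (suc n) x≤i =
  trans (cong (s (suc i)) (sProd-up-≤ (suc i) n (m≤n⇒m≤1+n x≤i))) (s-fix-< (suc i) (s≤s x≤i))

sProd-up-> : ∀ i n {x} → suc (i ℕ.+ n) < x → sProd (wordUp i n) x ≡ x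
sProd-up-> i zero    _         = refl
sProd-up-> i (suc n) {x} i+n<x =
  trans (cong (s (suc i)) (sProd-up-> (suc i) n i+n<x′))
        (s-fix-> (suc i) (≤-<-trans (s≤s (s≤s (m≤m+n i n))) i+n<x′))
  where
  i+n<x′ : suc (suc i ℕ.+ n) < x
  i+n<x′ = subst (λ m → suc m < x) (+-suc i n) i+n<x

sProd-up-top : ∀ i n → sProd (wordUp i n) (suc (i ℕ.+ n)) ≡ suc i
sProd-up-top i zero    = cong suc (+-identityʳ i)
sProd-up-top i (suc n) = begin
  s (suc i) (sProd (wordUp (suc i) n) (suc (i ℕ.+ suc n))) ≡⟨ cong (λ m → s (suc i) (sProd (wordUp (suc i) n) (suc m)))
                                                                    (+-suc i n) ⟩
  s (suc i) (sProd (wordUp (suc i) n) (suc (suc i ℕ.+ n))) ≡⟨ cong (s (suc i)) (sProd-up-top (suc i) n) ⟩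
  s (suc i) (suc (suc i))                                  ≡⟨ s-right (suc i) ⟩
  suc i                                                    ∎
  where open ≡-Reasoning

sProd-up-mid : ∀ i n {x} → i < x → x ≤ i ℕ.+ n → sProd (wordUp i n) x ≡ suc x
sProd-up-mid i zero    {x} i<x x≤i+0 = ⊥-elim (<⇒≱ i<x (subst (x ≤_) (+-identityʳ i) x≤i+0))
sProd-up-mid i (suc n) {x} i<x x≤i+n with x ≟ suc i
... | yes refl = trans (cong (s (suc i)) (sProd-up-≤ (suc i) n ≤-refl)) (s-left (suc i))
... | no x≢1+i =
  trans (cong (s (suc i)) (sProd-up-mid (suc i) n 1+i<x (subst (x ≤_) (+-suc i n) x≤i+n)))
        (s-fix-> (suc i) (s≤s 1+i<x))
  where
  1+i<x : suc i < x
  1+i<x = ≤∧≢⇒< i<x (x≢1+i ∘ sym)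

rev : ℕ → ℕ → ℕ
rev zero    x = x
rev (suc k) x = rev k (sProd (wordDown k) x)

isFinPerm-rev : ∀ k → IsFinPerm (rev k)
isFinPerm-rev zero    = isFinPerm-id
isFinPerm-rev (suc k) = isFinPerm-∘ (isFinPerm-rev k) (isFinPerm-sProd (wordDown-positive k))

rev-> : ∀ k {x} → k < x → rev k x ≡ x
rev-> zero    _     = refl
rev-> (suc k) k<x = trans (cong (rev k) (sProd-down-> k k<x)) (rev-> k (<-trans (n<1+n k) k<x))

rev-≤ : ∀ k {x} → 1 ≤ x → x ≤ k → rev k x ≡ suc k ∸ x
rev-≤ (suc k) {1}           _ _           = trans (cong (rev k) (sProd-down-1 k)) (rev-> k (n<1+n k))
rev-≤ (suc k) {suc (suc y)} _ (s≤s 1+y≤k) =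
  trans (cong (rev k) (sProd-down-suc k (s≤s z≤n) 1+y≤k)) (rev-≤ k (s≤s z≤n) 1+y≤k)

w₀-≤ : ∀ n {x} → 1 ≤ x → x ≤ n → w₀ n x ≡ suc n ∸ x
w₀-≤ n {suc y} _ x≤n = if-≤ᵇ-yes x≤n

w₀-> : ∀ n {x} → n < x → w₀ n x ≡ x
w₀-> n {suc y} n<x = if-≤ᵇ-no n<x

w₀≗rev : ∀ n x → w₀ n x ≡ rev n x
w₀≗rev n zero    = sym (proj₁ (isFinPerm-rev n))
w₀≗rev n (suc y) with suc y ≤? n
... | yes x≤n = trans (w₀-≤ n (s≤s z≤n) x≤n) (sym (rev-≤ n (s≤s z≤n) x≤n))
... | no  x≰n = trans (w₀-> n (≰⇒> x≰n)) (sym (rev-> n (≰⇒> x≰n)))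

isFinPerm-w₀ : ∀ n → IsFinPerm (w₀ n)
isFinPerm-w₀ n = isFinPerm-cong (λ x → sym (w₀≗rev n x)) (isFinPerm-rev n)

Decreasing : ℕ → (ℕ → ℕ) → Set
Decreasing k W = ∀ {p q} → 1 ≤ p → p < q → q ≤ k → W q < W p

w₀-decreasing : ∀ n → Decreasing n (w₀ n)
w₀-decreasing n {p} {q} 1≤p p<q q≤n =
  subst₂ _<_ (sym (w₀-≤ n (≤-trans 1≤p (<⇒≤ p<q)) q≤n)) (sym (w₀-≤ n 1≤p (≤-trans (<⇒≤ p<q) q≤n)))
    (∸-monoʳ-< p<q (m≤n⇒m≤1+n q≤n))

decreasing-weaken : ∀ {k W} → Decreasing (suc k) W → Decreasing k W
decreasing-weaken {k} W↓ 1≤p p<q q≤k = W↓ 1≤p p<q (m≤n⇒m≤1+n q≤k)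

rev-last-smallest : ∀ {k W} → Decreasing (suc k) W → ∀ {p} → 1 ≤ p → p ≤ k →
                    W (rev k (suc k)) < W (rev k p)
rev-last-smallest {k} {W} W↓ {suc p} 1≤p p≤k =
  subst₂ (λ x y → W x < W y) (sym (rev-> k (n<1+n k))) (sym (rev-≤ k 1≤p p≤k))
    (W↓ (m<n⇒0<n∸m p≤k) (s≤s (m∸n≤m k p)) ≤-refl)

w₀·up : ℕ → ℕ → ℕ → ℕ
w₀·up K j x = w₀ (suc K) (sProd (wordUp j (K ∸ j)) x)

isFinPerm-w₀·up : ∀ K j → IsFinPerm (w₀·up K j)
isFinPerm-w₀·up K j = isFinPerm-∘ (isFinPerm-w₀ (suc K)) (isFinPerm-sProd (wordUp-positive j (K ∸ j)))

module _ {K j} (j≤K : j ≤ K) where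

  private
    E = w₀·up K j

    j+[K∸j]≡K : j ℕ.+ (K ∸ j) ≡ K
    j+[K∸j]≡K = m+[n∸m]≡n j≤K

  w₀·up-≤ : ∀ {p} → 1 ≤ p → p ≤ j → E p ≡ suc (suc K) ∸ p
  w₀·up-≤ 1≤p p≤j =
    trans (cong (w₀ (suc K)) (sProd-up-≤ j (K ∸ j) p≤j)) (w₀-≤ (suc K) 1≤p (m≤n⇒m≤1+n (≤-trans p≤j j≤K)))

  w₀·up-mid : ∀ {p} → j < p → p ≤ K → E p ≡ suc K ∸ p
  w₀·up-mid j<p p≤K =
    trans (cong (w₀ (suc K)) (sProd-up-mid j (K ∸ j) j<p (subst (_ ≤_) (sym j+[K∸j]≡K) p≤K)))
          (w₀-≤ (suc K) (s≤s z≤n) (s≤s p≤K))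

  w₀·up-top : E (suc K) ≡ suc (K ∸ j)
  w₀·up-top = begin
    w₀ (suc K) (sProd (wordUp j (K ∸ j)) (suc K))               ≡⟨ cong (λ m → w₀ (suc K) (sProd (wordUp j (K ∸ j)) (suc m)))
                                                                       (sym j+[K∸j]≡K) ⟩
    w₀ (suc K) (sProd (wordUp j (K ∸ j)) (suc (j ℕ.+ (K ∸ j)))) ≡⟨ cong (w₀ (suc K)) (sProd-up-top j (K ∸ j)) ⟩
    w₀ (suc K) (suc j)                                          ≡⟨ w₀-≤ (suc K) (s≤s z≤n) (s≤s j≤K) ⟩
    suc K ∸ j                                                   ≡⟨ +-∸-assoc 1 j≤K ⟩
    suc (K ∸ j)                                                 ∎
    where open ≡-Reasoning

  w₀·up-> : ∀ {x} → suc K < x → E x ≡ x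
  w₀·up-> {x} 1+K<x =
    trans (cong (w₀ (suc K)) (sProd-up-> j (K ∸ j) (subst (λ m → suc m < x) (sym j+[K∸j]≡K) 1+K<x)))
          (w₀-> (suc K) 1+K<x)

  w₀·up-decreasing : Decreasing K E
  w₀·up-decreasing {p} {q} 1≤p p<q q≤K with p ≤? j | q ≤? j
  ... | yes p≤j | yes q≤j = subst₂ _<_ (sym (w₀·up-≤ (≤-trans 1≤p (<⇒≤ p<q)) q≤j))
                                         (sym (w₀·up-≤ 1≤p p≤j))
                              (∸-monoʳ-< p<q (m≤n⇒m≤1+n (m≤n⇒m≤1+n q≤K)))
  ... | yes p≤j | no  q≰j = subst₂ _<_ (sym (w₀·up-mid (≰⇒> q≰j) q≤K)) (sym (w₀·up-≤ 1≤p p≤j))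
                              (<-≤-trans (∸-monoʳ-< p<q (m≤n⇒m≤1+n q≤K)) (∸-monoˡ-≤ p (n≤1+n (suc K))))
  ... | no  p≰j | yes q≤j = ⊥-elim (p≰j (≤-trans (<⇒≤ p<q) q≤j))
  ... | no  p≰j | no  _   = subst₂ _<_ (sym (w₀·up-mid (<-trans (≰⇒> p≰j) p<q) q≤K))
                                         (sym (w₀·up-mid (≰⇒> p≰j) (≤-trans (<⇒≤ p<q) q≤K)))
                              (∸-monoʳ-< p<q (m≤n⇒m≤1+n q≤K))

  w₀·up∘rev≗[1^j∣K] : ∀ x → E (rev K x) ≡ perm1m|k j K x
  w₀·up∘rev≗[1^j∣K] zero = trans (cong E (proj₁ (isFinPerm-rev K))) (proj₁ (isFinPerm-w₀·up K j))
  w₀·up∘rev≗[1^j∣K] (suc y) with suc y ≤? K ∸ j | suc y ≤? K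
  ... | yes x≤K∸j | _ = begin
    E (rev K (suc y))   ≡⟨ cong E (rev-≤ K (s≤s z≤n) x≤K) ⟩
    E (K ∸ y)           ≡⟨ w₀·up-mid j<K∸y (m∸n≤m K y) ⟩
    suc K ∸ (K ∸ y)     ≡⟨ +-∸-assoc 1 (m∸n≤m K y) ⟩
    suc (K ∸ (K ∸ y))   ≡⟨ cong suc (m∸[m∸n]≡n (≤-trans (n≤1+n y) x≤K)) ⟩
    suc y               ≡⟨ sym (if-≤ᵇ-yes x≤K∸j) ⟩
    perm1m|k j K (suc y) ∎
    where
    open ≡-Reasoning
    x≤K = ≤-trans x≤K∸j (m∸n≤m K j)
    j<K∸y : j < K ∸ y
    j<K∸y = subst (_< K ∸ y) (m∸[m∸n]≡n j≤K) (∸-monoʳ-< x≤K∸j (m∸n≤m K j))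
  ... | no x≰K∸j | yes x≤K = begin
    E (rev K (suc y))         ≡⟨ cong E (rev-≤ K (s≤s z≤n) x≤K) ⟩
    E (K ∸ y)                 ≡⟨ w₀·up-≤ (m<n⇒0<n∸m x≤K) K∸y≤j ⟩
    suc (suc K) ∸ (K ∸ y)     ≡⟨ +-∸-assoc 2 (m∸n≤m K y) ⟩
    suc (suc (K ∸ (K ∸ y)))   ≡⟨ cong (suc ∘ suc) (m∸[m∸n]≡n (≤-trans (n≤1+n y) x≤K)) ⟩
    suc (suc y)               ≡⟨ sym (trans (if-≤ᵇ-no (≰⇒> x≰K∸j)) (if-≤ᵇ-yes x≤K)) ⟩
    perm1m|k j K (suc y)      ∎
    where
    open ≡-Reasoning
    K∸y≤j : K ∸ y ≤ j
    K∸y≤j = ≤-trans (∸-monoʳ-≤ K (m<1+n⇒m≤n (≰⇒> x≰K∸j))) (≤-reflexive (m∸[m∸n]≡n j≤K))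
  ... | no x≰K∸j | no x≰K with y ≟ K
  ...   | yes refl = begin
    E (rev y (suc y))         ≡⟨ cong E (rev-> y (n<1+n y)) ⟩
    E (suc y)                 ≡⟨ w₀·up-top ⟩
    suc (y ∸ j)               ≡⟨ sym (trans (if-≤ᵇ-no (≰⇒> x≰K∸j))
                                            (trans (if-≤ᵇ-no (≰⇒> x≰K)) (if-≡ᵇ-yes {m = suc y} refl))) ⟩
    perm1m|k j y (suc y)      ∎
    where open ≡-Reasoning
  ...   | no y≢K = begin
    E (rev K (suc y))         ≡⟨ cong E (rev-> K (≰⇒> x≰K)) ⟩
    E (suc y)                 ≡⟨ w₀·up-> (≤∧≢⇒< (≰⇒> x≰K) (y≢K ∘ suc-injective ∘ sym)) ⟩
    suc y                     ≡⟨ sym (trans (if-≤ᵇ-no (≰⇒> x≰K∸j))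
                                            (trans (if-≤ᵇ-no (≰⇒> x≰K)) (if-≡ᵇ-no (y≢K ∘ suc-injective)))) ⟩
    perm1m|k j K (suc y)      ∎
    where open ≡-Reasoning

prod-cong : ∀ n {f g : ℕ → ℤ} → (∀ {p} → 1 ≤ p → p ≤ n → f p ≡ g p) → prodFrom1 n f ≡ prodFrom1 n g
prod-cong zero    f≗g = refl
prod-cong (suc n) f≗g =
  cong₂ _*_ (prod-cong n λ 1≤p p≤n → f≗g 1≤p (m≤n⇒m≤1+n p≤n)) (f≗g (s≤s z≤n) ≤-refl)

prod-* : ∀ n (f g : ℕ → ℤ) → prodFrom1 n (λ p → f p * g p) ≡ prodFrom1 n f * prodFrom1 n g
prod-* zero    f g = refl
prod-* (suc n) f g = trans (cong (_* (f (suc n) * g (suc n))) (prod-* n f g))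
                           (interchange (prodFrom1 n f) (prodFrom1 n g) (f (suc n)) (g (suc n)))
  where
  interchange : ∀ a b c d → a * b * (c * d) ≡ a * c * (b * d)
  interchange = solve-∀

prod-≤ᵇ : ∀ n {j} (f : ℕ → ℤ) → j ≤ n → prodFrom1 n (λ p → if p ≤ᵇ j then f p else 1ℤ) ≡ prodFrom1 j f
prod-≤ᵇ zero        f z≤n = refl
prod-≤ᵇ (suc n) {j} f j≤1+n with m≤n⇒m<n∨m≡n j≤1+n
... | inj₁ j<1+n = trans (cong₂ _*_ (prod-≤ᵇ n f (m<1+n⇒m≤n j<1+n)) (if-≤ᵇ-no j<1+n)) (ℤₚ.*-identityʳ _)
... | inj₂ refl  = prod-cong (suc n) (λ _ p≤j → if-≤ᵇ-yes p≤j)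

prod-scale : ∀ n {P} (f g : ℕ → ℤ) c → 1 ≤ P → P ≤ n → (∀ {p} → p ≢ P → f p ≡ g p) → f P ≡ c * g P →
             prodFrom1 n f ≡ c * prodFrom1 n g
prod-scale zero    f g c (s≤s _) ()
prod-scale (suc n) {P} f g c 1≤P P≤1+n f≗g fP≡cgP with P ≟ suc n
... | yes refl = trans (cong₂ _*_ (prod-cong n λ _ p≤n → f≗g (<⇒≢ (s≤s p≤n))) fP≡cgP)
                       (swap-scalar (prodFrom1 n g) (g (suc n)) c)
  where
  swap-scalar : ∀ a b c → a * (c * b) ≡ c * (a * b)
  swap-scalar = solve-∀
... | no  P≢1+n =
  trans (cong₂ _*_ (prod-scale n f g c 1≤P (≤-suc-≢ P≤1+n P≢1+n) f≗g fP≡cgP) (f≗g (P≢1+n ∘ sym)))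
        (ℤₚ.*-assoc c _ _)

prod-swap : ∀ n (f : ℕ → ℤ) {r} → 1 ≤ r → suc r ≤ n → prodFrom1 n (λ p → f (s r p)) ≡ prodFrom1 n f
prod-swap (suc n) f {suc r} 1≤r 1+r≤1+n with m≤n⇒m<n∨m≡n 1+r≤1+n
... | inj₁ 1+r<1+n = cong₂ _*_ (prod-swap n f 1≤r (m<1+n⇒m≤n 1+r<1+n)) (cong f (s-fix-> (suc r) 1+r<1+n))
... | inj₂ refl    = begin
  prodFrom1 r (λ p → f (s (suc r) p)) * f (s (suc r) (suc r)) * f (s (suc r) (suc (suc r)))
    ≡⟨ cong₂ (λ x y → x * y * f (s (suc r) (suc (suc r)))) lower (cong f (s-left (suc r))) ⟩
  prodFrom1 r f * f (suc (suc r)) * f (s (suc r) (suc (suc r)))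
    ≡⟨ cong (λ x → prodFrom1 r f * f (suc (suc r)) * f x) (s-right (suc r)) ⟩
  prodFrom1 r f * f (suc (suc r)) * f (suc r)
    ≡⟨ swap-last (prodFrom1 r f) (f (suc (suc r))) (f (suc r)) ⟩
  prodFrom1 r f * f (suc r) * f (suc (suc r))
    ∎
  where
  open ≡-Reasoning
  lower : prodFrom1 r (λ p → f (s (suc r) p)) ≡ prodFrom1 r f
  lower = prod-cong r λ _ p≤r → cong f (s-fix-< (suc r) (s≤s p≤r))
  swap-last : ∀ a b c → a * b * c ≡ a * c * b
  swap-last = solve-∀

SymmetricIn : ℕ → (Assign → ℤ) → Set
SymmetricIn i f = ∀ a → f (swapA i a) ≡ f a

SymmetricUpTo : ℕ → (Assign → ℤ) → Set
SymmetricUpTo k f = ∀ {i} → 1 ≤ i → suc i ≤ k → SymmetricIn i f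

symmetricIn-+ : ∀ {i f g} → SymmetricIn i f → SymmetricIn i g → SymmetricIn i (λ a → f a + g a)
symmetricIn-+ f-sym g-sym a = cong₂ _+_ (f-sym a) (g-sym a)

symmetricIn-* : ∀ {i f g} → SymmetricIn i f → SymmetricIn i g → SymmetricIn i (λ a → f a * g a)
symmetricIn-* f-sym g-sym a = cong₂ _*_ (f-sym a) (g-sym a)

symmetricIn-neg : ∀ {i f} → SymmetricIn i f → SymmetricIn i (λ a → - f a)
symmetricIn-neg f-sym a = cong -_ (f-sym a)

symmetricIn-β : ∀ {i} (φ : ℤ → ℤ) → 1 ≤ i → SymmetricIn i (λ a → φ (a 0))
symmetricIn-β φ 1≤i a = cong (φ ∘ a) (s-fix-0 1≤i)

symmetricIn-prod : ∀ n (φ : ℤ → ℤ → ℤ) {i} → 1 ≤ i → suc i ≤ n →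
                   SymmetricIn i (λ a → prodFrom1 n (λ p → φ (a 0) (a p)))
symmetricIn-prod n φ {i} 1≤i 1+i≤n a =
  trans (cong (λ b → prodFrom1 n (λ p → φ b (a (s i p)))) (cong a (s-fix-0 1≤i)))
        (prod-swap n (λ p → φ (a 0) (a p)) 1≤i 1+i≤n)

symmetricIn-prod-below : ∀ n (φ : ℤ → ℤ → ℤ) {i} → 1 ≤ i → n < i →
                         SymmetricIn i (λ a → prodFrom1 n (λ p → φ (a 0) (a p)))
symmetricIn-prod-below n φ {i} 1≤i n<i a =
  trans (cong (λ b → prodFrom1 n (λ p → φ b (a (s i p)))) (cong a (s-fix-0 1≤i)))
        (prod-cong n λ _ p≤n → cong (φ (a 0) ∘ a) (s-fix-< i (≤-<-trans p≤n n<i)))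

monomial : ℕ → (ℕ → ℕ) → Assign → ℤ
monomial n e a = prodFrom1 n (λ p → a p ^ e p)

symmetricIn-monomial : ∀ n (e : ℕ → ℕ) {i} → 1 ≤ i → suc i ≤ n → (∀ p → e (s i p) ≡ e p) →
                       SymmetricIn i (monomial n e)
symmetricIn-monomial n e {i} 1≤i 1+i≤n e∘s≗e a =
  trans (prod-cong n λ {p} _ _ → cong (a (s i p) ^_) (sym (e∘s≗e p)))
        (prod-swap n (λ p → a p ^ e p) 1≤i 1+i≤n)

prodX : ℕ → Assign → ℤ
prodX n a = prodFrom1 n a

prod2+βX : ℕ → Assign → ℤ
prod2+βX n a = prodFrom1 n (λ i → + 2 + a 0 * a i)

δ : ℕ → Assign → ℤ
δ n = monomial n (n ∸_)

symmetricUpTo-weaken : ∀ {k g} → SymmetricUpTo (suc k) g → SymmetricUpTo k g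
symmetricUpTo-weaken g-sym 1≤i 1+i≤k = g-sym 1≤i (m≤n⇒m≤1+n 1+i≤k)

symmetricUpTo-prodX-* : ∀ {n g} → SymmetricUpTo n g → SymmetricUpTo n (λ a → prodX n a * g a)
symmetricUpTo-prodX-* {n} g-sym 1≤i 1+i≤n =
  symmetricIn-* (symmetricIn-prod n (λ _ x → x) 1≤i 1+i≤n) (g-sym 1≤i 1+i≤n)

δ-suc : ∀ n a → δ (suc n) a ≡ δ n a * prodX n a
δ-suc n a = begin
  prodFrom1 n (λ i → a i ^ (suc n ∸ i)) * a (suc n) ^ (n ∸ n)
    ≡⟨ cong₂ _*_ (prod-cong n λ {i} _ i≤n → cong (a i ^_) (+-∸-assoc 1 i≤n))
                 (cong (a (suc n) ^_) (n∸n≡0 n)) ⟩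
  prodFrom1 n (λ i → a i * a i ^ (n ∸ i)) * 1ℤ
    ≡⟨ ℤₚ.*-identityʳ _ ⟩
  prodFrom1 n (λ i → a i * a i ^ (n ∸ i))
    ≡⟨ prod-* n a (λ i → a i ^ (n ∸ i)) ⟩
  prodX n a * δ n a
    ≡⟨ ℤₚ.*-comm (prodX n a) (δ n a) ⟩
  δ n a * prodX n a
    ∎
  where open ≡-Reasoning

-- β-divided differences

-- IsDDβ i p h unfolds to IsDivDiff i (eval p) h.
IsDivDiff : ℕ → (Assign → ℤ) → (Assign → ℤ) → Set
IsDivDiff i f h =
  ∀ a → (a i - a (suc i)) * h a ≡ (+ 1 + a 0 * a (suc i)) * f a - (+ 1 + a 0 * a i) * f (swapA i a)

divDiff-cong : ∀ {i f f′ h h′} → (∀ a → f a ≡ f′ a) → (∀ a → h a ≡ h′ a) →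
               IsDivDiff i f h → IsDivDiff i f′ h′
divDiff-cong {i} f≗f′ h≗h′ ∂f a =
  trans (cong ((a i - a (suc i)) *_) (sym (h≗h′ a)))
        (trans (∂f a) (cong₂ (λ x y → (+ 1 + a 0 * a (suc i)) * x - (+ 1 + a 0 * a i) * y)
                             (f≗f′ a) (f≗f′ (swapA i a))))

divDiff-+ : ∀ {i f f′ h h′} → IsDivDiff i f h → IsDivDiff i f′ h′ →
            IsDivDiff i (λ a → f a + f′ a) (λ a → h a + h′ a)
divDiff-+ {i} {f} {f′} {h} {h′} ∂f ∂f′ a =
  trans (ℤₚ.*-distribˡ-+ (a i - a (suc i)) (h a) (h′ a))
        (trans (cong₂ _+_ (∂f a) (∂f′ a))
               (collect (+ 1 + a 0 * a (suc i)) (+ 1 + a 0 * a i) (f a) (f (swapA i a)) (f′ a) (f′ (swapA i a))))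
  where
  collect : ∀ u v x y x′ y′ → (u * x - v * y) + (u * x′ - v * y′) ≡ u * (x + x′) - v * (y + y′)
  collect = solve-∀

divDiff-scale : ∀ (c : ℤ → ℤ) {i f h} → 1 ≤ i → IsDivDiff i f h →
                IsDivDiff i (λ a → c (a 0) * f a) (λ a → c (a 0) * h a)
divDiff-scale c {i} {f} {h} 1≤i ∂f a = begin
  d * (c (a 0) * h a)                                   ≡⟨ pull d (c (a 0)) (h a) ⟩
  c (a 0) * (d * h a)                                   ≡⟨ cong (c (a 0) *_) (∂f a) ⟩
  c (a 0) * (u * f a - v * f (swapA i a))               ≡⟨ push (c (a 0)) u v (f a) (f (swapA i a)) ⟩
  u * (c (a 0) * f a) - v * (c (a 0) * f (swapA i a))   ≡⟨ cong (λ b → u * (c (a 0) * f a) - v * (c b * f (swapA i a)))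
                                                               (sym (cong a (s-fix-0 1≤i))) ⟩
  u * (c (a 0) * f a) - v * (c (a (s i 0)) * f (swapA i a)) ∎
  where
  open ≡-Reasoning
  d = a i - a (suc i)
  u = + 1 + a 0 * a (suc i)
  v = + 1 + a 0 * a i
  pull : ∀ d c h → d * (c * h) ≡ c * (d * h)
  pull = solve-∀
  push : ∀ c u v x y → c * (u * x - v * y) ≡ u * (c * x) - v * (c * y)
  push = solve-∀

divDiff-affine : ∀ (p q : ℤ → ℤ) {i f} → 1 ≤ i → SymmetricIn i f →
                 IsDivDiff i (λ a → (p (a 0) + q (a 0) * a i) * f a) (λ a → (q (a 0) - a 0 * p (a 0)) * f a)
divDiff-affine p q {i} {f} 1≤i f-sym a =
  trans (identity (a i) (a (suc i)) (a 0) (p (a 0)) (q (a 0)) (f a))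
        (cong (λ z → (+ 1 + a 0 * a (suc i)) * ((p (a 0) + q (a 0) * a i) * f a) - (+ 1 + a 0 * a i) * z)
              (sym swapped))
  where
  identity : ∀ x y b P Q F → (x - y) * ((Q - b * P) * F) ≡
             (+ 1 + b * y) * ((P + Q * x) * F) - (+ 1 + b * x) * ((P + Q * y) * F)
  identity = solve-∀
  swapped : (p (a (s i 0)) + q (a (s i 0)) * a (s i i)) * f (swapA i a) ≡ (p (a 0) + q (a 0) * a (suc i)) * f a
  swapped = cong₂ _*_ (cong₂ (λ b x → p b + q b * x) (cong a (s-fix-0 1≤i)) (cong a (s-left i))) (f-sym a)

divDiff-var : ∀ {i f} → 1 ≤ i → SymmetricIn i f → IsDivDiff i (λ a → a i * f a) f
divDiff-var {i} {f} 1≤i f-sym =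
  divDiff-cong (λ a → simplify-f (a i) (f a)) (λ a → simplify-h (a 0) (f a))
    (divDiff-affine (λ _ → 0ℤ) (λ _ → 1ℤ) 1≤i f-sym)
  where
  simplify-f : ∀ x F → (0ℤ + 1ℤ * x) * F ≡ x * F
  simplify-f = solve-∀
  simplify-h : ∀ b F → (1ℤ - b * 0ℤ) * F ≡ F
  simplify-h = solve-∀

sumFrom0 : ℕ → (ℕ → ℤ) → ℤ
sumFrom0 zero    f = f 0
sumFrom0 (suc m) f = sumFrom0 m f + f (suc m)

sumFrom0-cong : ∀ m {f g : ℕ → ℤ} → (∀ {j} → j ≤ m → f j ≡ g j) → sumFrom0 m f ≡ sumFrom0 m g
sumFrom0-cong zero    f≗g = f≗g z≤n
sumFrom0-cong (suc m) f≗g = cong₂ _+_ (sumFrom0-cong m (f≗g ∘ m≤n⇒m≤1+n)) (f≗g ≤-refl)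

sumFrom0-scale : ∀ m c (f : ℕ → ℤ) → sumFrom0 m (λ j → c * f j) ≡ c * sumFrom0 m f
sumFrom0-scale zero    c f = refl
sumFrom0-scale (suc m) c f =
  trans (cong (_+ c * f (suc m)) (sumFrom0-scale m c f)) (sym (ℤₚ.*-distribˡ-+ c (sumFrom0 m f) (f (suc m))))

sumFrom0≡head+sumFrom1 : ∀ m (f : ℕ → ℤ) → sumFrom0 m f ≡ f 0 + sumFrom1 m f
sumFrom0≡head+sumFrom1 zero    f = sym (ℤₚ.+-identityʳ (f 0))
sumFrom0≡head+sumFrom1 (suc m) f =
  trans (cong (_+ f (suc m)) (sumFrom0≡head+sumFrom1 m f)) (ℤₚ.+-assoc (f 0) (sumFrom1 m f) (f (suc m)))

divDiff-sumFrom0 : ∀ m {i} {F H : ℕ → Assign → ℤ} → (∀ {j} → j ≤ m → IsDivDiff i (F j) (H j)) →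
                   IsDivDiff i (λ a → sumFrom0 m (λ j → F j a)) (λ a → sumFrom0 m (λ j → H j a))
divDiff-sumFrom0 zero    ∂F = ∂F z≤n
divDiff-sumFrom0 (suc m) ∂F = divDiff-+ (divDiff-sumFrom0 m (∂F ∘ m≤n⇒m≤1+n)) (∂F ≤-refl)

swapA-injective : ∀ {N i a} → suc i ≤ N → InjectiveUpTo N a → InjectiveUpTo N (swapA i a)
swapA-injective {i = i} 1+i≤N inj p≤N q≤N eq = s-injective i (inj (s-≤ 1+i≤N p≤N) (s-≤ 1+i≤N q≤N) eq)

-- On injective points x_i ≠ x_{i+1}, so the divided difference is determined there.
divDiff-unique : ∀ {N i f f′ h h′} → suc i ≤ N → IsDivDiff i f h → IsDivDiff i f′ h′ →
                 f ≐[ N ] f′ → h ≐[ N ] h′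
divDiff-unique {N} {i} {f} {f′} {h} {h′} 1+i≤N ∂f ∂f′ f≐f′ a inj =
  ℤₚ.*-cancelˡ-≡ d (h a) (h′ a) {{ℤ.≢-nonZero d≢0}} (begin
    d * h a                                              ≡⟨ ∂f a ⟩
    (+ 1 + a 0 * a (suc i)) * f a - (+ 1 + a 0 * a i) * f (swapA i a)
      ≡⟨ cong₂ (λ x y → (+ 1 + a 0 * a (suc i)) * x - (+ 1 + a 0 * a i) * y)
               (f≐f′ a inj) (f≐f′ (swapA i a) (swapA-injective 1+i≤N inj)) ⟩
    (+ 1 + a 0 * a (suc i)) * f′ a - (+ 1 + a 0 * a i) * f′ (swapA i a) ≡⟨ sym (∂f′ a) ⟩
    d * h′ a                                             ∎)
  where
  open ≡-Reasoning
  d = a i - a (suc i)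
  d≢0 : d ≢ 0ℤ
  d≢0 d≡0 = 1+n≢n (sym (inj (≤-trans (n≤1+n i) 1+i≤N) 1+i≤N (ℤₚ.i-j≡0⇒i≡j _ _ d≡0)))

DescentsAlong : (ℕ → ℕ) → List ℕ → Set
DescentsAlong V []      = ⊤
DescentsAlong V (i ∷ l) = V (suc i) < V i × DescentsAlong (λ x → V (s i x)) l

data DivDiffs (N : ℕ) : List ℕ → (Assign → ℤ) → (Assign → ℤ) → Set where
  []   : ∀ {f} → DivDiffs N [] f f
  step : ∀ {i l f g h} → 1 ≤ i → suc i ≤ N → IsDivDiff i f g → DivDiffs N l g h → DivDiffs N (i ∷ l) f h

descents-down : ∀ r {V} → (∀ {p} → 1 ≤ p → p ≤ r → V (suc r) < V p) → DescentsAlong V (wordDown r)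
descents-down zero        _  = tt
descents-down (suc r) {V} V↓ =
  V↓ (s≤s z≤n) ≤-refl ,
  descents-down r λ 1≤p p≤r →
    subst₂ _<_ (cong V (sym (s-left (suc r)))) (cong V (sym (s-fix-< (suc r) (s≤s p≤r))))
               (V↓ 1≤p (m≤n⇒m≤1+n p≤r))

descents-up : ∀ i n {V} → (∀ {p} → suc i < p → p ≤ suc (i ℕ.+ n) → V p < V (suc i)) →
              DescentsAlong V (wordUp i n)
descents-up i zero        _  = tt
descents-up i (suc n) {V} V↓ =
  V↓ ≤-refl (s≤s (subst (suc i ≤_) (sym (+-suc i n)) (s≤s (m≤m+n i n)))) ,
  descents-up (suc i) n λ {p} 2+i<p p≤ →
    subst₂ _<_ (cong V (sym (s-fix-> (suc i) 2+i<p))) (cong V (sym (s-right (suc i))))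
               (V↓ (<-trans (n<1+n _) 2+i<p) (subst (λ m → p ≤ suc m) (sym (+-suc i n)) p≤))

divDiffs-down : ∀ {N} r (R : ℕ → Assign → ℤ) → suc r ≤ N →
                (∀ {t} → t < r → IsDivDiff (suc t) (R (suc t)) (R t)) → DivDiffs N (wordDown r) (R r) (R 0)
divDiffs-down zero    R _     _  = []
divDiffs-down (suc r) R 2+r≤N ∂R =
  step (s≤s z≤n) 2+r≤N (∂R ≤-refl) (divDiffs-down r R (≤-trans (n≤1+n _) 2+r≤N) (∂R ∘ m<n⇒m<1+n))

divDiffs-up : ∀ {N} i n (Q : ℕ → Assign → ℤ) → suc (i ℕ.+ n) ≤ N →
              (∀ {t} → i ≤ t → t < i ℕ.+ n → IsDivDiff (suc t) (Q t) (Q (suc t))) →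
              DivDiffs N (wordUp i n) (Q i) (Q (i ℕ.+ n))
divDiffs-up {N} i zero    Q _     _  = subst (DivDiffs N [] (Q i) ∘ Q) (sym (+-identityʳ i)) []
divDiffs-up {N} i (suc n) Q bound ∂Q =
  step (s≤s z≤n) (≤-trans (s≤s (s≤s (m≤m+n i n))) bound′)
       (∂Q ≤-refl (subst (i <_) (sym (+-suc i n)) (s≤s (m≤m+n i n))))
       (subst (DivDiffs N (wordUp (suc i) n) (Q (suc i)) ∘ Q) (sym (+-suc i n))
         (divDiffs-up (suc i) n Q bound′ λ {t} i<t t< → ∂Q (<⇒≤ i<t) (subst (t <_) (sym (+-suc i n)) t<)))
  where
  bound′ : suc (suc i ℕ.+ n) ≤ N
  bound′ = subst (λ m → suc m ≤ N) (+-suc i n) bound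

-- The exponents of x^{δ_{K+1}} after ∂_{j+1}, …, ∂_r: one less at the positions j < p ≤ r.
exponent : ℕ → ℕ → ℕ → ℕ → ℕ
exponent K j r p = if p ≤ᵇ j then suc K ∸ p else (if p ≤ᵇ r then K ∸ p else suc K ∸ p)

module _ {K j : ℕ} where

  exponent-start : ∀ p → exponent K j j p ≡ suc K ∸ p
  exponent-start p with p ≤ᵇ j
  ... | true  = refl
  ... | false = refl

  module _ {t} (j≤t : j ≤ t) (t<K : t < K) where

    exponent-other : ∀ {p} → p ≢ suc t → exponent K j t p ≡ exponent K j (suc t) p
    exponent-other {p} p≢1+t with p ≤ᵇ j | p ≤? t
    ... | true  | _       = refl
    ... | false | yes p≤t = trans (if-≤ᵇ-yes p≤t) (sym (if-≤ᵇ-yes (m≤n⇒m≤1+n p≤t)))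
    ... | false | no  p≰t =
      trans (if-≤ᵇ-no (≰⇒> p≰t)) (sym (if-≤ᵇ-no (≤∧≢⇒< (≰⇒> p≰t) (p≢1+t ∘ sym))))

    exponent-before : exponent K j t (suc t) ≡ suc (K ∸ suc t)
    exponent-before = trans (if-≤ᵇ-no (s≤s j≤t)) (trans (if-≤ᵇ-no (n<1+n t)) (+-∸-assoc 1 t<K))

    exponent-after : exponent K j (suc t) (suc t) ≡ K ∸ suc t
    exponent-after = trans (if-≤ᵇ-no (s≤s j≤t)) (if-≤ᵇ-yes {m = suc t} ≤-refl)

    exponent-after-next : exponent K j (suc t) (suc (suc t)) ≡ K ∸ suc t
    exponent-after-next = trans (if-≤ᵇ-no (s≤s (m≤n⇒m≤1+n j≤t))) (if-≤ᵇ-no (n<1+n (suc t)))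

    exponent-after-sym : ∀ p → exponent K j (suc t) (s (suc t) p) ≡ exponent K j (suc t) p
    exponent-after-sym p with p ≟ suc t | p ≟ suc (suc t)
    ... | yes refl | _        =
      trans (cong (exponent K j (suc t)) (s-left p)) (trans exponent-after-next (sym exponent-after))
    ... | no _     | yes refl =
      trans (cong (exponent K j (suc t)) (s-right (suc t))) (trans exponent-after (sym exponent-after-next))
    ... | no p≢    | no p≢′   = cong (exponent K j (suc t)) (s-fix (suc t) p≢ p≢′)

    divDiff-monomial : IsDivDiff (suc t) (monomial (suc K) (exponent K j t)) (monomial (suc K) (exponent K j (suc t)))
    divDiff-monomial =
      divDiff-cong (λ a → sym (factor a)) (λ _ → refl)
        (divDiff-var (s≤s z≤n) (symmetricIn-monomial (suc K) _ (s≤s z≤n) (s≤s t<K) exponent-after-sym))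
      where
      factor : ∀ a → monomial (suc K) (exponent K j t) a ≡ a (suc t) * monomial (suc K) (exponent K j (suc t)) a
      factor a =
        prod-scale (suc K) _ _ (a (suc t)) (s≤s z≤n) (m≤n⇒m≤1+n t<K) (cong (a _ ^_) ∘ exponent-other)
          (trans (cong (a (suc t) ^_) exponent-before) (cong (λ e → a (suc t) * a (suc t) ^ e) (sym exponent-after)))

  monomial-end : j ≤ K → ∀ a → monomial (suc K) (exponent K j K) a ≡ δ K a * prodX j a * 1ℤ
  monomial-end j≤K a = cong₂ _*_ lower (cong (a (suc K) ^_) last)
    where
    open ≡-Reasoning
    last : exponent K j K (suc K) ≡ 0
    last = trans (if-≤ᵇ-no (s≤s j≤K)) (trans (if-≤ᵇ-no (n<1+n K)) (n∸n≡0 K))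
    pointwise : ∀ {p} → 1 ≤ p → p ≤ K →
                a p ^ exponent K j K p ≡ a p ^ (K ∸ p) * (if p ≤ᵇ j then a p else 1ℤ)
    pointwise {p} _ p≤K with p ≤ᵇ j
    ... | true  = trans (cong (a p ^_) (+-∸-assoc 1 p≤K)) (ℤₚ.*-comm (a p) _)
    ... | false = trans (cong (a p ^_) (if-≤ᵇ-yes p≤K)) (sym (ℤₚ.*-identityʳ _))
    lower : prodFrom1 K (λ p → a p ^ exponent K j K p) ≡ δ K a * prodX j a
    lower = begin
      prodFrom1 K (λ p → a p ^ exponent K j K p)
        ≡⟨ prod-cong K pointwise ⟩
      prodFrom1 K (λ p → a p ^ (K ∸ p) * (if p ≤ᵇ j then a p else 1ℤ))
        ≡⟨ prod-* K (λ p → a p ^ (K ∸ p)) _ ⟩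
      δ K a * prodFrom1 K (λ p → if p ≤ᵇ j then a p else 1ℤ)
        ≡⟨ cong (δ K a *_) (prod-≤ᵇ K a j≤K) ⟩
      δ K a * prodX j a
        ∎

coeff : ℕ → ℕ → ℤ → ℤ
coeff k j b = (+ 2) ^ (k ∸ j) * (- b) ^ j

polyFun-prod2+βX : ∀ n → IsPolynomialFunction (prod2+βX n)
polyFun-prod2+βX n = polyFun-prod n (λ i a → + 2 + a 0 * a i) λ i →
  polyFun-+ (polyFun-const (+ 2)) (polyFun-* (polyFun-var 0) (polyFun-var i))

polyFun-2^k-Σcoeff : ∀ k (P : ℕ → Poly) →
                     IsPolynomialFunction (λ a → (+ 2) ^ k - sumFrom1 k (λ j → coeff k j (a 0) * eval (P j) a))
polyFun-2^k-Σcoeff k P =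
  polyFun-+ (polyFun-const ((+ 2) ^ k)) (polyFun-neg (polyFun-sum k (λ j a → coeff k j (a 0) * eval (P j) a) λ j →
    polyFun-* (polyFun-* (polyFun-const ((+ 2) ^ (k ∸ j))) (polyFun-^ j (polyFun-neg (polyFun-var 0))))
              (polyFun-eval (P j))))

ψ : ℕ → Assign → ℤ
ψ K a = (+ 2) ^ suc K - prod2+βX K a + (- a 0) ^ K * prodX K a

-- Closed form of ∂_{t+1} ⋯ ∂_{K-1} applied to
-- Φ K σ (K - 1) = 2 x₁⋯x_{K-1} σ (2^K - ∏_{i<K} (2 + β xᵢ)) + (-β)^K x₁⋯x_{K-1} x₁⋯x_K σ  (Φ-last).
Φ : ℕ → (Assign → ℤ) → ℕ → Assign → ℤ
Φ K σ t a = σ a * (prodX t a * ψ K a - (- a 0) ^ (K ∸ t) * prod2+βX t a * prodX K a)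

symmetricUpTo-ψ : ∀ K → SymmetricUpTo K (ψ K)
symmetricUpTo-ψ K 1≤i 1+i≤K =
  symmetricIn-+ (symmetricIn-+ (symmetricIn-β (λ _ → (+ 2) ^ suc K) 1≤i)
                               (symmetricIn-neg (symmetricIn-prod K (λ b x → + 2 + b * x) 1≤i 1+i≤K)))
                (symmetricIn-* (symmetricIn-β (λ b → (- b) ^ K) 1≤i) (symmetricIn-prod K (λ _ x → x) 1≤i 1+i≤K))

Φ-0 : ∀ K σ a → Φ K σ 0 a ≡ σ a * ((+ 2) ^ suc K - prod2+βX K a)
Φ-0 K σ a = identity (σ a) ((+ 2) ^ suc K) (prod2+βX K a) ((- a 0) ^ K) (prodX K a)
  where
  identity : ∀ s E Π F P → s * (1ℤ * (E - Π + F * P) - F * 1ℤ * P) ≡ s * (E - Π)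
  identity = solve-∀

Φ-last : ∀ k σ a → + 2 * (prodX k a * σ a * ((+ 2) ^ suc k - prod2+βX k a)) +
                   1ℤ * (- a 0) ^ suc k * (prodX k a * (prodX (suc k) a * σ a)) ≡ Φ (suc k) σ k a
Φ-last k σ a =
  trans (identity (prodX k a) (σ a) ((+ 2) ^ suc k) (prod2+βX k a) ((- a 0) ^ suc k) (a (suc k)) (a 0))
        (cong (λ n → σ a * (prodX k a * ψ (suc k) a - (- a 0) ^ n * prod2+βX k a * prodX (suc k) a))
              (sym (m+n∸n≡m 1 k)))
  where
  identity : ∀ P s E Π F x b →
             + 2 * (P * s * (E - Π)) + 1ℤ * F * (P * (P * x * s)) ≡
             s * (P * (+ 2 * E - Π * (+ 2 + b * x) + F * (P * x)) - (- b * 1ℤ) * Π * (P * x))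
  identity = solve-∀

divDiff-Φ : ∀ {K σ t} → SymmetricUpTo K σ → suc t < K → IsDivDiff (suc t) (Φ K σ (suc t)) (Φ K σ t)
divDiff-Φ {K} {σ} {t} σ-sym 1+t<K =
  divDiff-cong f-form h-form
    (divDiff-+ (divDiff-affine (λ _ → 0ℤ) (λ _ → 1ℤ) (s≤s z≤n) f₁-sym)
               (divDiff-affine (λ _ → + 2) (λ b → b) (s≤s z≤n) f₂-sym))
  where
  f₁ f₂ : Assign → ℤ
  f₁ a = σ a * prodX t a * ψ K a
  f₂ a = - ((- a 0) ^ (K ∸ suc t) * σ a * prod2+βX t a * prodX K a)
  f₁-sym : SymmetricIn (suc t) f₁
  f₁-sym = symmetricIn-* (symmetricIn-* (σ-sym (s≤s z≤n) 1+t<K)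
                                        (symmetricIn-prod-below t (λ _ x → x) (s≤s z≤n) (n<1+n t)))
                         (symmetricUpTo-ψ K (s≤s z≤n) 1+t<K)
  f₂-sym : SymmetricIn (suc t) f₂
  f₂-sym = symmetricIn-neg
    (symmetricIn-* (symmetricIn-* (symmetricIn-* (symmetricIn-β {suc t} (λ b → (- b) ^ (K ∸ suc t)) (s≤s z≤n))
                                                 (σ-sym (s≤s z≤n) 1+t<K))
                                  (symmetricIn-prod-below t (λ b x → + 2 + b * x) (s≤s z≤n) (n<1+n t)))
                   (symmetricIn-prod K (λ _ x → x) (s≤s z≤n) 1+t<K))
  f-identity : ∀ x b s P A e Π PK → (0ℤ + 1ℤ * x) * (s * P * A) + (+ 2 + b * x) * (- (e * s * Π * PK)) ≡
               s * (P * x * A - e * (Π * (+ 2 + b * x)) * PK)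
  f-identity = solve-∀
  h-identity : ∀ b s P A e Π PK → (1ℤ - b * 0ℤ) * (s * P * A) + (b - b * + 2) * (- (e * s * Π * PK)) ≡
               s * (P * A - (- b * e) * Π * PK)
  h-identity = solve-∀
  f-form : ∀ a → (0ℤ + 1ℤ * a (suc t)) * f₁ a + (+ 2 + a 0 * a (suc t)) * f₂ a ≡ Φ K σ (suc t) a
  f-form a = f-identity (a (suc t)) (a 0) (σ a) (prodX t a) (ψ K a) ((- a 0) ^ (K ∸ suc t)) (prod2+βX t a) (prodX K a)
  h-form : ∀ a → (1ℤ - a 0 * 0ℤ) * f₁ a + (a 0 - a 0 * + 2) * f₂ a ≡ Φ K σ t a
  h-form a =
    trans (h-identity (a 0) (σ a) (prodX t a) (ψ K a) ((- a 0) ^ (K ∸ suc t)) (prod2+βX t a) (prodX K a))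
          (cong (λ n → σ a * (prodX t a * ψ K a - (- a 0) ^ n * prod2+βX t a * prodX K a))
                (sym (+-∸-assoc 1 (<⇒≤ 1+t<K))))

-- Grothendieck polynomials

module _ (G : (ℕ → ℕ) → Poly) (isG : IsGrothendieck G) (N : ℕ) where

  open IsGrothendieck isG

  linComb : ℕ → (ℕ → ℤ → ℤ) → (ℕ → ℕ → ℕ) → Assign → ℤ
  linComb m c V a = sumFrom0 m (λ j → c j (a 0) * eval (G (V j)) a)

  linComb-along : ∀ l {m c V f h} → (∀ {j} → j ≤ m → IsFinPerm (V j)) →
                  (∀ {j} → j ≤ m → DescentsAlong (V j) l) → DivDiffs N l f h →
                  linComb m c V ≐[ N ] f → linComb m c (λ j x → V j (sProd l x)) ≐[ N ] h
  linComb-along []      _ _ [] linComb≐f = linComb≐f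
  linComb-along (i ∷ l) {m} {c} {V} V-perm V-desc (step 1≤i 1+i≤N ∂f ∂s) linComb≐f =
    linComb-along l {m} {c} (λ j≤m → isFinPerm-∘ (V-perm j≤m) (isFinPerm-s 1≤i)) (proj₂ ∘ V-desc) ∂s
      (divDiff-unique 1+i≤N ∂linComb ∂f linComb≐f)
    where
    ∂linComb : IsDivDiff i (linComb m c V) (linComb m c (λ j x → V j (s i x)))
    ∂linComb = divDiff-sumFrom0 m λ {j} j≤m →
      divDiff-scale (c j) 1≤i (desc (V j) (V-perm j≤m) i 1≤i (proj₁ (V-desc j≤m)))

  G-along : ∀ l {V f h} → IsFinPerm V → DescentsAlong V l → DivDiffs N l f h →
            eval (G V) ≐[ N ] f → eval (G (λ x → V (sProd l x))) ≐[ N ] h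
  G-along l {V} V-perm V-desc ∂s G≐f a inj =
    trans (sym (ℤₚ.*-identityˡ _))
          (linComb-along l {0} {λ _ _ → 1ℤ} {λ _ → V} (λ _ → V-perm) (λ _ → V-desc) ∂s
                         (λ a inj → trans (ℤₚ.*-identityˡ _) (G≐f a inj)) a inj)

  G-reverse : ∀ k {W g} → k ≤ N → IsFinPerm W → Decreasing k W → SymmetricUpTo k g →
              eval (G W) ≐[ N ] (λ a → δ k a * g a) → eval (G (λ x → W (rev k x))) ≐[ N ] g
  G-reverse zero    _ _ _ _ G≐δg a inj = trans (G≐δg a inj) (ℤₚ.*-identityˡ _)
  G-reverse (suc k) {W} {g} 1+k≤N W-perm W↓ g-sym G≐δg a inj =
    trans (G-along (wordDown k) (isFinPerm-∘ W-perm (isFinPerm-rev k)) (descents-down k (rev-last-smallest W↓))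
                   (divDiffs-down k (λ t a → prodX t a * g a) 1+k≤N ∂-step) IH a inj)
          (ℤₚ.*-identityˡ (g a))
    where
    IH : eval (G (λ x → W (rev k x))) ≐[ N ] (λ a → prodX k a * g a)
    IH = G-reverse k (≤-trans (n≤1+n k) 1+k≤N) W-perm (decreasing-weaken W↓)
           (symmetricUpTo-prodX-* (symmetricUpTo-weaken g-sym))
           λ a inj → trans (G≐δg a inj) (trans (cong (_* g a) (δ-suc k a)) (ℤₚ.*-assoc (δ k a) (prodX k a) (g a)))
    ∂-step : ∀ {t} → t < k → IsDivDiff (suc t) (λ a → prodX (suc t) a * g a) (λ a → prodX t a * g a)
    ∂-step {t} t<k =
      divDiff-cong (λ a → reassoc (a (suc t)) (prodX t a) (g a)) (λ _ → refl)
        (divDiff-var (s≤s z≤n) (symmetricIn-* (symmetricIn-prod-below t (λ _ x → x) (s≤s z≤n) (n<1+n t))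
                                              (g-sym (s≤s z≤n) (s≤s t<k))))
      where
      reassoc : ∀ x P g → x * (P * g) ≡ P * x * g
      reassoc = solve-∀

  G-reverse-linComb : ∀ k {W : ℕ → ℕ → ℕ} {σ} → k ≤ N → (∀ {j} → j ≤ k → IsFinPerm (W j)) →
                      (∀ {j} → j ≤ k → Decreasing k (W j)) → SymmetricUpTo k σ →
                      (∀ {j} → j ≤ k → eval (G (W j)) ≐[ N ] (λ a → δ k a * prodX j a * σ a)) →
                      linComb k (coeff k) (λ j x → W j (rev k x)) ≐[ N ] (λ a → σ a * ((+ 2) ^ suc k - prod2+βX k a))
  G-reverse-linComb zero {σ = σ} _ _ _ _ G≐ a inj =
    trans (cong (1ℤ * 1ℤ *_) (G≐ z≤n a inj)) (simplify (σ a))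
    where
    simplify : ∀ x → 1ℤ * 1ℤ * (1ℤ * 1ℤ * x) ≡ x * (+ 2 * 1ℤ - 1ℤ)
    simplify = solve-∀
  G-reverse-linComb (suc k) {W} {σ} 1+k≤N W-perm W↓ σ-sym G≐ a inj =
    trans (linComb-along (wordDown k) {suc k} {coeff (suc k)} {V}
             (λ j≤ → isFinPerm-∘ (W-perm j≤) (isFinPerm-rev k))
             (λ j≤ → descents-down k (rev-last-smallest (W↓ j≤)))
             (divDiffs-down k (Φ (suc k) σ) 1+k≤N (divDiff-Φ σ-sym ∘ s≤s)) base a inj)
          (Φ-0 (suc k) σ a)
    where
    V : ℕ → ℕ → ℕ
    V j x = W j (rev k x)

    IH : linComb k (coeff k) V ≐[ N ] (λ a → prodX k a * σ a * ((+ 2) ^ suc k - prod2+βX k a))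
    IH = G-reverse-linComb k (≤-trans (n≤1+n k) 1+k≤N) (W-perm ∘ m≤n⇒m≤1+n)
           (decreasing-weaken ∘ W↓ ∘ m≤n⇒m≤1+n)
           (symmetricUpTo-prodX-* (symmetricUpTo-weaken σ-sym))
           λ {j} j≤k a inj → trans (G≐ (m≤n⇒m≤1+n j≤k) a inj)
             (trans (cong (λ d → d * prodX j a * σ a) (δ-suc k a)) (reassoc (δ k a) (prodX k a) (prodX j a) (σ a)))
      where
      reassoc : ∀ D Pk Pj s → D * Pk * Pj * s ≡ D * Pj * (Pk * s)
      reassoc = solve-∀

    G-last : eval (G (V (suc k))) ≐[ N ] (λ a → prodX k a * (prodX (suc k) a * σ a))
    G-last = G-reverse k (≤-trans (n≤1+n k) 1+k≤N) (W-perm ≤-refl) (decreasing-weaken (W↓ ≤-refl))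
               (symmetricUpTo-prodX-* (symmetricUpTo-weaken (symmetricUpTo-prodX-* σ-sym)))
               λ a inj → trans (G≐ ≤-refl a inj)
                 (trans (cong (λ d → d * prodX (suc k) a * σ a) (δ-suc k a))
                        (reassoc (δ k a) (prodX k a) (prodX (suc k) a) (σ a)))
      where
      reassoc : ∀ D Pk PK s → D * Pk * PK * s ≡ D * (Pk * (PK * s))
      reassoc = solve-∀

    lower : ∀ a → InjectiveUpTo N a →
            linComb k (coeff (suc k)) V a ≡ + 2 * (prodX k a * σ a * ((+ 2) ^ suc k - prod2+βX k a))
    lower a inj = trans (sumFrom0-cong k double) (trans (sumFrom0-scale k (+ 2) _) (cong (+ 2 *_) (IH a inj)))
      where
      double : ∀ {j} → j ≤ k →
               coeff (suc k) j (a 0) * eval (G (V j)) a ≡ + 2 * (coeff k j (a 0) * eval (G (V j)) a)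
      double {j} j≤k =
        trans (cong (λ n → (+ 2) ^ n * (- a 0) ^ j * eval (G (V j)) a) (+-∸-assoc 1 j≤k))
              (reassoc ((+ 2) ^ (k ∸ j)) ((- a 0) ^ j) (eval (G (V j)) a))
        where
        reassoc : ∀ X Y g → + 2 * X * Y * g ≡ + 2 * (X * Y * g)
        reassoc = solve-∀

    base : linComb (suc k) (coeff (suc k)) V ≐[ N ] Φ (suc k) σ k
    base a inj =
      trans (cong₂ _+_ (lower a inj)
                       (cong₂ _*_ (cong (λ n → (+ 2) ^ n * (- a 0) ^ suc k) (n∸n≡0 k)) (G-last a inj)))
            (Φ-last k σ a)

  G-w₀·up : ∀ {K j} → suc K ≤ N → j ≤ K → eval (G (w₀·up K j)) ≐[ N ] (λ a → δ K a * prodX j a * 1ℤ)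
  G-w₀·up {K} {j} 1+K≤N j≤K a inj =
    trans (G-along (wordUp j (K ∸ j)) (isFinPerm-w₀ (suc K)) (descents-up j (K ∸ j) w₀↓)
                   (divDiffs-up j (K ∸ j) (λ r → monomial (suc K) (exponent K j r)) bound ∂) G-top a inj)
          (trans (cong (λ r → monomial (suc K) (exponent K j r) a) j+[K∸j]≡K) (monomial-end j≤K a))
    where
    j+[K∸j]≡K : j ℕ.+ (K ∸ j) ≡ K
    j+[K∸j]≡K = m+[n∸m]≡n j≤K
    bound : suc (j ℕ.+ (K ∸ j)) ≤ N
    bound = subst (λ m → suc m ≤ N) (sym j+[K∸j]≡K) 1+K≤N
    w₀↓ : ∀ {p} → suc j < p → p ≤ suc (j ℕ.+ (K ∸ j)) → w₀ (suc K) p < w₀ (suc K) (suc j)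
    w₀↓ {p} 1+j<p p≤ = w₀-decreasing (suc K) (s≤s z≤n) 1+j<p (subst (λ m → p ≤ suc m) j+[K∸j]≡K p≤)
    ∂ : ∀ {t} → j ≤ t → t < j ℕ.+ (K ∸ j) →
        IsDivDiff (suc t) (monomial (suc K) (exponent K j t)) (monomial (suc K) (exponent K j (suc t)))
    ∂ {t} j≤t t< = divDiff-monomial j≤t (subst (t <_) j+[K∸j]≡K t<)
    G-top : eval (G (w₀ (suc K))) ≐[ N ] monomial (suc K) (exponent K j j)
    G-top a _ = trans (top (suc K) a) (prod-cong (suc K) λ {p} _ _ → cong (a p ^_) (sym (exponent-start {K} {j} p)))

  G-[1^0∣K] : ∀ K a → eval (G (perm1m|k 0 K)) a ≡ 1ℤ
  G-[1^0∣K] K a = trans (resp (perm1m|k 0 K) (w₀ 0) [1^0∣K]≗w₀ a) (top 0 a)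
    where
    [1^0∣K]≗w₀ : ∀ x → perm1m|k 0 K x ≡ w₀ 0 x
    [1^0∣K]≗w₀ zero    = refl
    [1^0∣K]≗w₀ (suc y) with suc y ≤? K | y ≟ K
    ... | yes x≤K | _        = if-≤ᵇ-yes x≤K
    ... | no  x≰K | yes refl =
      trans (if-≤ᵇ-no (≰⇒> x≰K)) (trans (if-≤ᵇ-no (≰⇒> x≰K)) (if-≡ᵇ-yes {m = suc y} refl))
    ... | no  x≰K | no  y≢K  =
      trans (if-≤ᵇ-no (≰⇒> x≰K)) (trans (if-≤ᵇ-no (≰⇒> x≰K)) (if-≡ᵇ-no (y≢K ∘ suc-injective)))

  linComb-[1^j∣K] : ∀ {K} → suc K ≤ N →
                    linComb K (coeff K) (λ j → perm1m|k j K) ≐[ N ] (λ a → 1ℤ * ((+ 2) ^ suc K - prod2+βX K a))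
  linComb-[1^j∣K] {K} 1+K≤N a inj =
    trans (sumFrom0-cong K λ {j} j≤K → cong (coeff K j (a 0) *_) (resp _ _ (sym ∘ w₀·up∘rev≗[1^j∣K] j≤K) a))
          (G-reverse-linComb K (≤-trans (n≤1+n K) 1+K≤N) (λ {j} _ → isFinPerm-w₀·up K j) w₀·up-decreasing
                             (λ _ _ _ → refl) (G-w₀·up 1+K≤N) a inj)

  prod2+βX≐ : ∀ {K} → suc K ≤ N →
              prod2+βX K ≐[ N ] (λ a → (+ 2) ^ K - sumFrom1 K (λ j → coeff K j (a 0) * eval (G (perm1m|k j K)) a))
  prod2+βX≐ {K} 1+K≤N a inj = begin
    Π                               ≡⟨ unfold E Π ⟩
    + 2 * E - 1ℤ * (+ 2 * E - Π)     ≡⟨ cong (λ x → + 2 * E - x) (sym split) ⟩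
    + 2 * E - (E * 1ℤ * 1ℤ + S)      ≡⟨ fold E S ⟩
    E - S                           ∎
    where
    open ≡-Reasoning
    Π = prod2+βX K a
    E = (+ 2) ^ K
    S = sumFrom1 K (λ j → coeff K j (a 0) * eval (G (perm1m|k j K)) a)
    split : E * 1ℤ * 1ℤ + S ≡ 1ℤ * (+ 2 * E - Π)
    split = trans (cong (λ g → E * 1ℤ * g + S) (sym (G-[1^0∣K] K a)))
                  (trans (sym (sumFrom0≡head+sumFrom1 K _)) (linComb-[1^j∣K] 1+K≤N a inj))
    unfold : ∀ E Π → Π ≡ + 2 * E - 1ℤ * (+ 2 * E - Π)
    unfold = solve-∀
    fold : ∀ E S → + 2 * E - (E * 1ℤ * 1ℤ + S) ≡ E - S
    fold = solve-∀

lemma3p15 : (G : (ℕ → ℕ) → Poly) → IsGrothendieck G →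
    ∀ (k : ℕ) → 1 ≤ k → ∀ (a : Assign) →
      prodFrom1 k (λ i → + 2 + a 0 * a i)
        ≡ (+ 2) ^ k
          - sumFrom1 k (λ j → (+ 2) ^ (k ∸ j) * (- a 0) ^ j
                                * eval (G (perm1m|k j k)) a)
lemma3p15 G isG k _ =
  polyFun-≐⇒≡ (polyFun-prod2+βX k) (polyFun-2^k-Σcoeff k (λ j → G (perm1m|k j k)))
              (suc k) (prod2+βX≐ G isG (suc k) ≤-refl)
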